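{- Let $k\ge 2$ and let $w,g_1,\dots,g_k$ be indeterminates; work in the field of rational functions $\mathbb{Q}(w,g_1,\dots,g_k)$. For $m\ge 1$ let $\mathbf{M}_m$ be the $m\times m$ matrix with entries $$(\mathbf{M}_m)_{i,i}=1,\qquad (\mathbf{M}_m)_{i,i+1}=-g_i w\ (1\le i\le m-1),\qquad (\mathbf{M}_m)_{i,j}=-g_i \text{ for all other } j\ne i,$$ let $\mathbf{e}_m=[1,1,\dots,1]$ (a row vector of length $m$), $\mathbf{y}_m=[g_1,\dots,g_m]^T$ and $\mathbf{z}_m=[g_1,\dots,g_{m-1},w g_m]^T$, and define $$\mathcal{G}_m=\mathbf{e}_m\mathbf{M}_m^{ -1}\mathbf{y}_m,\qquad \mathcal{H}_m=\mathbf{e}_m\mathbf{M}_m^{ -1}\mathbf{z}_m .$$ Then $\mathcal{G}_1=g_1$, $\mathcal{H}_1=wg_1$, and $$\mathcal{G}_{k}=\mathcal{G}_{k-1}+\frac{g_k(1+\mathcal{G}_{k-1})(1+\mathcal{H}_{k-1})}{1-g_k\mathcal{H}_{k-1}},\qquad \mathcal{H}_{k}=\mathcal{G}_{k-1}+\frac{g_k(w+\mathcal{G}_{k-1})(1+\mathcal{H}_{k-1})}{1-g_k\mathcal{H}_{k-1}}.$$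
   Context: In the paper, $\mathcal{G}_k$ is the generating function (in terms of the generating functions $g_i$ of the individual integers $i$, with $w$ marking increasing successions) of sequences over $\{1,\dots,k\}$, and $\mathcal{H}_k$ is an auxiliary function; here both are defined directly by the matrix formulas in the claim. -}

module Defs where

open import Data.Nat as ℕ using (ℕ; zero; suc; _∸_)
open import Data.Fin as Fin using (Fin; toℕ)
open import Data.Bool using (if_then_else_)
open import Data.Product using (_×_)
open import Relation.Nullary using (¬_)
open import Relation.Nullary.Decidable using (⌊_⌋)
open import Relation.Binary.PropositionalEquality using (_≡_)
open import Data.Rational as ℚ using (ℚ; 0ℚ; 1ℚ)

-- Polynomials are formal ring expressions with rational coefficients;
-- two polynomials are equal iff they agree at every rational point
-- (over the infinite field ℚ this is exactly equality of polynomials).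

infixl 6 _⊕_
infixl 7 _⊗_

data Poly : Set where
  con : ℚ → Poly
  var : ℕ → Poly
  _⊕_ : Poly → Poly → Poly
  _⊗_ : Poly → Poly → Poly
  ⊝_  : Poly → Poly

eval : (ℕ → ℚ) → Poly → ℚ
eval ρ (con c) = c
eval ρ (var i) = ρ i
eval ρ (p ⊕ q) = eval ρ p ℚ.+ eval ρ q
eval ρ (p ⊗ q) = eval ρ p ℚ.* eval ρ q
eval ρ (⊝ p)   = ℚ.- eval ρ p

infix 4 _≈ₚ_
_≈ₚ_ : Poly → Poly → Set
p ≈ₚ q = ∀ (ρ : ℕ → ℚ) → eval ρ p ≡ eval ρ q

-- The field of rational functions ℚ(w, g₁, g₂, …) as fractions num/den.
-- Only fractions with nonzero denominator ('Proper') are genuine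
-- elements; equality is cross-multiplication.

record Frac : Set where
  constructor _/_
  field
    num : Poly
    den : Poly
open Frac public

Proper : Frac → Set
Proper f = ¬ (den f ≈ₚ con 0ℚ)

infix 4 _≃_
_≃_ : Frac → Frac → Set
a ≃ b = num a ⊗ den b ≈ₚ num b ⊗ den a

infixl 6 _+_ _-_
infixl 7 _*_

↑ : Poly → Frac
↑ p = p / con 1ℚ

0F 1F : Frac
0F = ↑ (con 0ℚ)
1F = ↑ (con 1ℚ)

_+_ : Frac → Frac → Frac
a + b = (num a ⊗ den b ⊕ num b ⊗ den a) / (den a ⊗ den b)

_*_ : Frac → Frac → Frac
a * b = (num a ⊗ num b) / (den a ⊗ den b)

-_ : Frac → Frac
- a = (⊝ num a) / den a

_-_ : Frac → Frac → Frac
a - b = a + (- b)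

w : Frac
w = ↑ (var 0)

g : ℕ → Frac        -- g i = gᵢ (meaningful for i ≥ 1)
g i = ↑ (var i)

Σ : ∀ {m} → (Fin m → Frac) → Frac
Σ {zero}  f = 0F
Σ {suc m} f = f Fin.zero + Σ (λ i → f (Fin.suc i))

Mat : ℕ → Set
Mat m = Fin m → Fin m → Frac

_·_ : ∀ {m} → Mat m → Mat m → Mat m
(A · B) i j = Σ (λ l → A i l * B l j)

I : ∀ {m} → Mat m
I i j = if ⌊ i Fin.≟ j ⌋ then 1F else 0F

IsInverse : ∀ {m} → Mat m → Mat m → Set
IsInverse A N = (∀ i j → Proper (N i j))
              × (∀ i j → (A · N) i j ≃ I i j)
              × (∀ i j → (N · A) i j ≃ I i j)

-- Row/column indices i, j : Fin m stand for 1-based indices i+1, j+1.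
-- (M_m)_{i,i} = 1, (M_m)_{i,i+1} = -gᵢ w, (M_m)_{i,j} = -gᵢ otherwise.
M : (m : ℕ) → Mat m
M m i j =
  if ⌊ i Fin.≟ j ⌋ then 1F
  else (if ⌊ toℕ j ℕ.≟ suc (toℕ i) ⌋ then - (g (suc (toℕ i)) * w)
        else - g (suc (toℕ i)))

y : (m : ℕ) → Fin m → Frac
y m j = g (suc (toℕ j))

z : (m : ℕ) → Fin m → Frac
z m j = if ⌊ suc (toℕ j) ℕ.≟ m ⌋ then w * g m else g (suc (toℕ j))

eNv : ∀ {m} → Mat m → (Fin m → Frac) → Frac
eNv N v = Σ (λ i → Σ (λ j → N i j * v j))

𝒢 : (m : ℕ) → Mat m → Frac
𝒢 m N = eNv N (y m)

ℋ : (m : ℕ) → Mat m → Frac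
ℋ m N = eNv N (z m)

{-# OPTIONS --safe #-}
-- Everything is checked at rational points. Two fractions are equal once their values agree
-- wherever a nonzero polynomial D (the product of all denominators involved) does not
-- vanish: restricted to a line through a point with D ≠ 0, this reduces to the fact that a
-- univariate polynomial with infinitely many roots is zero. At such a point M_k is the
-- bordered matrix [[M_{k-1}, -z_{k-1}], [-g_k ⋯ -g_k, 1]], and eliminating the last unknown
-- of M_k x = y_k (resp. z_k) gives e x = 𝒢_{k-1} + X (1 + ℋ_{k-1}), where
-- X (1 - g_k ℋ_{k-1}) = g_k (1 + 𝒢_{k-1}) (resp. g_k (w + 𝒢_{k-1})).
module Submission where

open import Defs
open import Data.Nat as ℕ using (ℕ; zero; suc; _≤_; _∸_; z≤n; s≤s)
open import Data.Product using (_×_; _,_; proj₁; proj₂; ∃)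
import Data.Nat.Properties as ℕ
open import Data.List using (List; []; _∷_; length; map)
open import Data.Rational as ℚ using (ℚ; 0ℚ; 1ℚ)
  renaming (_+_ to infixl 6 _+ℚ_; _*_ to infixl 7 _*ℚ_; -_ to infix 8 -ℚ_; _-_ to infixl 6 _-ℚ_; _<_ to _<ℚ_)
import Data.Rational.Properties as ℚ
open import Algebra.Apartness.Properties.HeytingCommutativeRing ℚ.heytingCommutativeRing
  using (x#0y#0→xy#0)
open import Algebra.Properties.Group ℚ.+-0-group using (x∙y⁻¹≈ε⇒x≈y)
open import Data.Fin as Fin using (Fin; toℕ; inject₁; fromℕ)
open import Data.Fin.Properties using (toℕ<n; toℕ-inject₁; toℕ-fromℕ; inject₁-injective; fromℕ≢inject₁)
open import Function using (_∘_)
open import Data.Vec.Functional using (init; last)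
open import Data.Bool using (Bool; true; false; if_then_else_)
open import Algebra.Bundles using (CommutativeRing)
open import Algebra.Properties.Semiring.Sum (CommutativeRing.semiring ℚ.+-*-commutativeRing)
  using (sum; sum-cong-≗; sum-replicate-zero; sum-init-last; ∑-comm; ∑-distrib-+; *-distribˡ-sum; *-distribʳ-sum)
open import Relation.Nullary using (¬_; Dec; yes; no)
open import Relation.Nullary.Decidable using (⌊_⌋; decidable-stable; isYes≗does; dec-true; dec-false)
open import Relation.Nullary.Decidable.Core using (dec⇒maybe)
open import Relation.Binary.PropositionalEquality
open import Tactic.RingSolver using (solve-∀)
open import Tactic.RingSolver.Core.AlmostCommutativeRing using (AlmostCommutativeRing; fromCommutativeRing)

ℚ-ring : AlmostCommutativeRing _ _
ℚ-ring = fromCommutativeRing ℚ.+-*-commutativeRing (λ x → dec⇒maybe (0ℚ ℚ.≟ x))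

x*y≡0⇒y≡0 : ∀ {x y} → x ≢ 0ℚ → x *ℚ y ≡ 0ℚ → y ≡ 0ℚ
x*y≡0⇒y≡0 {x} {y} x≢0 xy≡0 = begin
  y                 ≡⟨ sym (ℚ.*-identityˡ y) ⟩
  1ℚ *ℚ y           ≡⟨ cong (_*ℚ y) (ℚ.*-inverseˡ x) ⟨
  x⁻¹ *ℚ x *ℚ y     ≡⟨ ℚ.*-assoc x⁻¹ x y ⟩
  x⁻¹ *ℚ (x *ℚ y)   ≡⟨ cong (x⁻¹ *ℚ_) xy≡0 ⟩
  x⁻¹ *ℚ 0ℚ         ≡⟨ ℚ.*-zeroʳ x⁻¹ ⟩
  0ℚ                ∎
  where
  open ≡-Reasoning
  instance
    x-nonZero : ℚ.NonZero x
    x-nonZero = ℚ.≢-nonZero x≢0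
  x⁻¹ : ℚ
  x⁻¹ = ℚ.1/ x

x*y≡0⇒x≡0 : ∀ {x y} → y ≢ 0ℚ → x *ℚ y ≡ 0ℚ → x ≡ 0ℚ
x*y≡0⇒x≡0 {x} {y} y≢0 xy≡0 = x*y≡0⇒y≡0 y≢0 (trans (ℚ.*-comm y x) xy≡0)

x*y≢0⇒x≢0 : ∀ {x y} → x *ℚ y ≢ 0ℚ → x ≢ 0ℚ
x*y≢0⇒x≢0 {y = y} xy≢0 refl = xy≢0 (ℚ.*-zeroˡ y)

x*y≢0⇒y≢0 : ∀ {x y} → x *ℚ y ≢ 0ℚ → y ≢ 0ℚ
x*y≢0⇒y≢0 {x} xy≢0 refl = xy≢0 (ℚ.*-zeroʳ x)

x-y≡0⇒x≡y : ∀ {x y} → x -ℚ y ≡ 0ℚ → x ≡ y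
x-y≡0⇒x≡y {x} {y} = x∙y⁻¹≈ε⇒x≈y x y

x<y⇒y-x≢0 : ∀ {x y} → x <ℚ y → y -ℚ x ≢ 0ℚ
x<y⇒y-x≢0 x<y y-x≡0 = ℚ.<⇒≢ x<y (sym (x-y≡0⇒x≡y y-x≡0))

x<x+1 : ∀ x → x <ℚ x +ℚ 1ℚ
x<x+1 x = subst (_<ℚ x +ℚ 1ℚ) (ℚ.+-identityʳ x) (ℚ.+-mono-≤-< (ℚ.≤-refl {x}) (ℚ.positive⁻¹ 1ℚ))

Poly₁ : Set
Poly₁ = List ℚ

eval₁ : Poly₁ → ℚ → ℚ
eval₁ []      t = 0ℚ
eval₁ (a ∷ f) t = a +ℚ t *ℚ eval₁ f t

infixl 6 _+₁_
infixl 7 _*₁_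

_+₁_ : Poly₁ → Poly₁ → Poly₁
[]      +₁ h       = h
(a ∷ f) +₁ []      = a ∷ f
(a ∷ f) +₁ (b ∷ h) = a +ℚ b ∷ f +₁ h

_*₁_ : Poly₁ → Poly₁ → Poly₁
[]      *₁ h = []
(a ∷ f) *₁ h = map (a *ℚ_) h +₁ (0ℚ ∷ f *₁ h)

-₁_ : Poly₁ → Poly₁
-₁ f = map (λ a → -ℚ a) f

eval₁-+ : ∀ f h t → eval₁ (f +₁ h) t ≡ eval₁ f t +ℚ eval₁ h t
eval₁-+ []      h       t = sym (ℚ.+-identityˡ _)
eval₁-+ (a ∷ f) []      t = sym (ℚ.+-identityʳ _)
eval₁-+ (a ∷ f) (b ∷ h) t =
  trans (cong (λ x → a +ℚ b +ℚ t *ℚ x) (eval₁-+ f h t)) (regroup a b t (eval₁ f t) (eval₁ h t))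
  where
  regroup : ∀ a b t x y → a +ℚ b +ℚ t *ℚ (x +ℚ y) ≡ a +ℚ t *ℚ x +ℚ (b +ℚ t *ℚ y)
  regroup = solve-∀ ℚ-ring

eval₁-scale : ∀ c h t → eval₁ (map (c *ℚ_) h) t ≡ c *ℚ eval₁ h t
eval₁-scale c []      t = sym (ℚ.*-zeroʳ c)
eval₁-scale c (b ∷ h) t =
  trans (cong (λ x → c *ℚ b +ℚ t *ℚ x) (eval₁-scale c h t)) (regroup c b t (eval₁ h t))
  where
  regroup : ∀ c b t x → c *ℚ b +ℚ t *ℚ (c *ℚ x) ≡ c *ℚ (b +ℚ t *ℚ x)
  regroup = solve-∀ ℚ-ring

eval₁-* : ∀ f h t → eval₁ (f *₁ h) t ≡ eval₁ f t *ℚ eval₁ h t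
eval₁-* []      h t = sym (ℚ.*-zeroˡ (eval₁ h t))
eval₁-* (a ∷ f) h t = begin
  eval₁ (map (a *ℚ_) h +₁ (0ℚ ∷ f *₁ h)) t
    ≡⟨ eval₁-+ (map (a *ℚ_) h) (0ℚ ∷ f *₁ h) t ⟩
  eval₁ (map (a *ℚ_) h) t +ℚ (0ℚ +ℚ t *ℚ eval₁ (f *₁ h) t)
    ≡⟨ cong₂ (λ x y → x +ℚ (0ℚ +ℚ t *ℚ y)) (eval₁-scale a h t) (eval₁-* f h t) ⟩
  a *ℚ eval₁ h t +ℚ (0ℚ +ℚ t *ℚ (eval₁ f t *ℚ eval₁ h t))
    ≡⟨ regroup a t (eval₁ f t) (eval₁ h t) ⟩
  (a +ℚ t *ℚ eval₁ f t) *ℚ eval₁ h t ∎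
  where
  open ≡-Reasoning
  regroup : ∀ a t x y → a *ℚ y +ℚ (0ℚ +ℚ t *ℚ (x *ℚ y)) ≡ (a +ℚ t *ℚ x) *ℚ y
  regroup = solve-∀ ℚ-ring

eval₁-neg : ∀ f t → eval₁ (-₁ f) t ≡ -ℚ eval₁ f t
eval₁-neg []      t = refl
eval₁-neg (a ∷ f) t =
  trans (cong (λ x → -ℚ a +ℚ t *ℚ x) (eval₁-neg f t)) (regroup a t (eval₁ f t))
  where
  regroup : ∀ a t x → -ℚ a +ℚ t *ℚ (-ℚ x) ≡ -ℚ (a +ℚ t *ℚ x)
  regroup = solve-∀ ℚ-ring

-- Synthetic division by t - r.
quot : ℚ → Poly₁ → Poly₁
quot r []          = []
quot r (a ∷ [])    = []
quot r (a ∷ b ∷ f) = eval₁ (b ∷ f) r ∷ quot r (b ∷ f)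

length-quot : ∀ r f → length (quot r f) ≡ ℕ.pred (length f)
length-quot r []          = refl
length-quot r (a ∷ [])    = refl
length-quot r (a ∷ b ∷ f) = cong suc (length-quot r (b ∷ f))

eval₁-quot : ∀ r f t → eval₁ f t ≡ (t -ℚ r) *ℚ eval₁ (quot r f) t +ℚ eval₁ f r
eval₁-quot r []          t = sym (identity (t -ℚ r))
  where
  identity : ∀ x → x *ℚ 0ℚ +ℚ 0ℚ ≡ 0ℚ
  identity = solve-∀ ℚ-ring
eval₁-quot r (a ∷ [])    t = identity a t r
  where
  identity : ∀ a t r → a +ℚ t *ℚ 0ℚ ≡ (t -ℚ r) *ℚ 0ℚ +ℚ (a +ℚ r *ℚ 0ℚ)
  identity = solve-∀ ℚ-ring
eval₁-quot r (a ∷ b ∷ f) t =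
  trans (cong (λ x → a +ℚ t *ℚ x) (eval₁-quot r (b ∷ f) t))
        (regroup a t r (eval₁ (b ∷ f) r) (eval₁ (quot r (b ∷ f)) t))
  where
  regroup : ∀ a t r F Q → a +ℚ t *ℚ ((t -ℚ r) *ℚ Q +ℚ F) ≡ (t -ℚ r) *ℚ (F +ℚ t *ℚ Q) +ℚ (a +ℚ r *ℚ F)
  regroup = solve-∀ ℚ-ring

factor-root : ∀ r f → eval₁ f r ≡ 0ℚ → ∀ t → eval₁ f t ≡ (t -ℚ r) *ℚ eval₁ (quot r f) t
factor-root r f fr≡0 t = begin
  eval₁ f t                                      ≡⟨ eval₁-quot r f t ⟩
  (t -ℚ r) *ℚ eval₁ (quot r f) t +ℚ eval₁ f r    ≡⟨ cong ((t -ℚ r) *ℚ eval₁ (quot r f) t +ℚ_) fr≡0 ⟩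
  (t -ℚ r) *ℚ eval₁ (quot r f) t +ℚ 0ℚ           ≡⟨ ℚ.+-identityʳ _ ⟩
  (t -ℚ r) *ℚ eval₁ (quot r f) t                 ∎
  where open ≡-Reasoning

-- Each step divides out the root s + 1 and moves the half-line to the right of it.
vanishes-above⇒vanishes : ∀ n f → length f ≤ n → ∀ s →
                          (∀ t → s <ℚ t → eval₁ f t ≡ 0ℚ) → ∀ t → eval₁ f t ≡ 0ℚ
vanishes-above⇒vanishes zero    []  _     _ _    _ = refl
vanishes-above⇒vanishes (suc n) f ∣f∣≤1+n s f≡0 t = begin
  eval₁ f t             ≡⟨ factor-root r f (f≡0 r (x<x+1 s)) t ⟩
  (t -ℚ r) *ℚ eval₁ q t ≡⟨ cong ((t -ℚ r) *ℚ_) (q≡0 t) ⟩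
  (t -ℚ r) *ℚ 0ℚ        ≡⟨ ℚ.*-zeroʳ (t -ℚ r) ⟩
  0ℚ                    ∎
  where
  open ≡-Reasoning
  r : ℚ
  r = s +ℚ 1ℚ
  q : Poly₁
  q = quot r f
  ∣q∣≤n : length q ≤ n
  ∣q∣≤n = subst (_≤ n) (sym (length-quot r f)) (ℕ.pred-mono-≤ ∣f∣≤1+n)
  q≡0 : ∀ t → eval₁ q t ≡ 0ℚ
  q≡0 = vanishes-above⇒vanishes n q ∣q∣≤n r λ t r<t →
    x*y≡0⇒y≡0 (x<y⇒y-x≢0 r<t)
      (trans (sym (factor-root r f (f≡0 r (x<x+1 s)) t)) (f≡0 t (ℚ.<-trans (x<x+1 s) r<t)))

vanishes-off-0⇒vanishes : ∀ f → (∀ t → t ≢ 0ℚ → eval₁ f t ≡ 0ℚ) → ∀ t → eval₁ f t ≡ 0ℚ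
vanishes-off-0⇒vanishes f f≡0 =
  vanishes-above⇒vanishes (length f) f ℕ.≤-refl 0ℚ λ t 0<t → f≡0 t (≢-sym (ℚ.<⇒≢ 0<t))

-- For f = a ∷ f′: a = 0 since h(0) ≠ 0, so t f′(t) h(t) = 0; thus f′ h vanishes off 0,
-- hence everywhere, and induction applies to f′.
product-vanishes⇒vanishes : ∀ f h → eval₁ h 0ℚ ≢ 0ℚ →
                            (∀ t → eval₁ f t *ℚ eval₁ h t ≡ 0ℚ) → ∀ t → eval₁ f t ≡ 0ℚ
product-vanishes⇒vanishes []      h h0≢0 fh≡0 t = refl
product-vanishes⇒vanishes (a ∷ f) h h0≢0 fh≡0 t = begin
  a +ℚ t *ℚ eval₁ f t   ≡⟨ cong₂ (λ a x → a +ℚ t *ℚ x) a≡0 (f≡0 t) ⟩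
  0ℚ +ℚ t *ℚ 0ℚ         ≡⟨ zero-sum t ⟩
  0ℚ                    ∎
  where
  open ≡-Reasoning
  zero-sum : ∀ t → 0ℚ +ℚ t *ℚ 0ℚ ≡ 0ℚ
  zero-sum = solve-∀ ℚ-ring
  at-0 : ∀ a x → a +ℚ 0ℚ *ℚ x ≡ a
  at-0 = solve-∀ ℚ-ring
  shift : ∀ t x y → t *ℚ (x *ℚ y) ≡ (0ℚ +ℚ t *ℚ x) *ℚ y
  shift = solve-∀ ℚ-ring
  a≡0 : a ≡ 0ℚ
  a≡0 = x*y≡0⇒x≡0 h0≢0 (trans (cong (_*ℚ eval₁ h 0ℚ) (sym (at-0 a (eval₁ f 0ℚ)))) (fh≡0 0ℚ))
  f*h≡0-off-0 : ∀ t → t ≢ 0ℚ → eval₁ (f *₁ h) t ≡ 0ℚ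
  f*h≡0-off-0 t t≢0 = x*y≡0⇒y≡0 t≢0 (begin
    t *ℚ eval₁ (f *₁ h) t                  ≡⟨ cong (t *ℚ_) (eval₁-* f h t) ⟩
    t *ℚ (eval₁ f t *ℚ eval₁ h t)          ≡⟨ shift t (eval₁ f t) (eval₁ h t) ⟩
    (0ℚ +ℚ t *ℚ eval₁ f t) *ℚ eval₁ h t    ≡⟨ cong (λ a → (a +ℚ t *ℚ eval₁ f t) *ℚ eval₁ h t) a≡0 ⟨
    (a +ℚ t *ℚ eval₁ f t) *ℚ eval₁ h t     ≡⟨ fh≡0 t ⟩
    0ℚ                                     ∎)
  f≡0 : ∀ t → eval₁ f t ≡ 0ℚ
  f≡0 = product-vanishes⇒vanishes f h h0≢0 λ t →
    trans (sym (eval₁-* f h t)) (vanishes-off-0⇒vanishes (f *₁ h) f*h≡0-off-0 t)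

eval-cong : ∀ {ρ σ} → (∀ i → ρ i ≡ σ i) → ∀ p → eval ρ p ≡ eval σ p
eval-cong ρ≗σ (con c) = refl
eval-cong ρ≗σ (var i) = ρ≗σ i
eval-cong ρ≗σ (p ⊕ q) = cong₂ _+ℚ_ (eval-cong ρ≗σ p) (eval-cong ρ≗σ q)
eval-cong ρ≗σ (p ⊗ q) = cong₂ _*ℚ_ (eval-cong ρ≗σ p) (eval-cong ρ≗σ q)
eval-cong ρ≗σ (⊝ p)   = cong -ℚ_ (eval-cong ρ≗σ p)

segment : (ℕ → ℚ) → (ℕ → ℚ) → ℚ → ℕ → ℚ
segment ρ₀ ρ₁ t i = ρ₀ i +ℚ t *ℚ (ρ₁ i -ℚ ρ₀ i)

restrict : (ℕ → ℚ) → (ℕ → ℚ) → Poly → Poly₁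
restrict ρ₀ ρ₁ (con c) = c ∷ []
restrict ρ₀ ρ₁ (var i) = ρ₀ i ∷ ρ₁ i -ℚ ρ₀ i ∷ []
restrict ρ₀ ρ₁ (p ⊕ q) = restrict ρ₀ ρ₁ p +₁ restrict ρ₀ ρ₁ q
restrict ρ₀ ρ₁ (p ⊗ q) = restrict ρ₀ ρ₁ p *₁ restrict ρ₀ ρ₁ q
restrict ρ₀ ρ₁ (⊝ p)   = -₁ restrict ρ₀ ρ₁ p

eval₁-restrict : ∀ ρ₀ ρ₁ p t → eval₁ (restrict ρ₀ ρ₁ p) t ≡ eval (segment ρ₀ ρ₁ t) p
eval₁-restrict ρ₀ ρ₁ (con c) t = constant c t
  where
  constant : ∀ c t → c +ℚ t *ℚ 0ℚ ≡ c
  constant = solve-∀ ℚ-ring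
eval₁-restrict ρ₀ ρ₁ (var i) t = linear (ρ₀ i) (ρ₁ i) t
  where
  linear : ∀ a b t → a +ℚ t *ℚ ((b -ℚ a) +ℚ t *ℚ 0ℚ) ≡ a +ℚ t *ℚ (b -ℚ a)
  linear = solve-∀ ℚ-ring
eval₁-restrict ρ₀ ρ₁ (p ⊕ q) t =
  trans (eval₁-+ (restrict ρ₀ ρ₁ p) (restrict ρ₀ ρ₁ q) t)
        (cong₂ _+ℚ_ (eval₁-restrict ρ₀ ρ₁ p t) (eval₁-restrict ρ₀ ρ₁ q t))
eval₁-restrict ρ₀ ρ₁ (p ⊗ q) t =
  trans (eval₁-* (restrict ρ₀ ρ₁ p) (restrict ρ₀ ρ₁ q) t)
        (cong₂ _*ℚ_ (eval₁-restrict ρ₀ ρ₁ p t) (eval₁-restrict ρ₀ ρ₁ q t))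
eval₁-restrict ρ₀ ρ₁ (⊝ p) t =
  trans (eval₁-neg (restrict ρ₀ ρ₁ p) t) (cong -ℚ_ (eval₁-restrict ρ₀ ρ₁ p t))

eval₁-restrict-0 : ∀ ρ₀ ρ₁ p → eval₁ (restrict ρ₀ ρ₁ p) 0ℚ ≡ eval ρ₀ p
eval₁-restrict-0 ρ₀ ρ₁ p =
  trans (eval₁-restrict ρ₀ ρ₁ p 0ℚ) (eval-cong (λ i → start (ρ₀ i) (ρ₁ i)) p)
  where
  start : ∀ a b → a +ℚ 0ℚ *ℚ (b -ℚ a) ≡ a
  start = solve-∀ ℚ-ring

eval₁-restrict-1 : ∀ ρ₀ ρ₁ p → eval₁ (restrict ρ₀ ρ₁ p) 1ℚ ≡ eval ρ₁ p
eval₁-restrict-1 ρ₀ ρ₁ p =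
  trans (eval₁-restrict ρ₀ ρ₁ p 1ℚ) (eval-cong (λ i → end (ρ₀ i) (ρ₁ i)) p)
  where
  end : ∀ a b → a +ℚ 1ℚ *ℚ (b -ℚ a) ≡ b
  end = solve-∀ ℚ-ring

-- Restricted to the line from a point ρ₀ with q(ρ₀) ≠ 0 to ρ₁, p q vanishes identically
-- while q is nonzero at ρ₀, so p vanishes at ρ₁.
vanishes-off-zeros : ∀ p q → ¬ (q ≈ₚ con 0ℚ) →
                     (∀ ρ → eval ρ q ≢ 0ℚ → eval ρ p ≡ 0ℚ) → p ≈ₚ con 0ℚ
vanishes-off-zeros p q q≉0 p≡0 ρ₁ =
  decidable-stable (eval ρ₁ p ℚ.≟ 0ℚ) λ p₁≢0 →
    q≉0 λ ρ₀ → decidable-stable (eval ρ₀ q ℚ.≟ 0ℚ) λ q₀≢0 → p₁≢0 (along-line ρ₀ q₀≢0)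
  where
  along-line : ∀ ρ₀ → eval ρ₀ q ≢ 0ℚ → eval ρ₁ p ≡ 0ℚ
  along-line ρ₀ q₀≢0 =
    trans (sym (eval₁-restrict-1 ρ₀ ρ₁ p))
          (product-vanishes⇒vanishes P Q Q0≢0 PQ≡0 1ℚ)
    where
    P : Poly₁
    P = restrict ρ₀ ρ₁ p
    Q : Poly₁
    Q = restrict ρ₀ ρ₁ q
    Q0≢0 : eval₁ Q 0ℚ ≢ 0ℚ
    Q0≢0 Q0≡0 = q₀≢0 (trans (sym (eval₁-restrict-0 ρ₀ ρ₁ q)) Q0≡0)
    PQ≡0 : ∀ t → eval₁ P t *ℚ eval₁ Q t ≡ 0ℚ
    PQ≡0 t with eval₁ Q t ℚ.≟ 0ℚ
    ... | yes Qt≡0 = trans (cong (eval₁ P t *ℚ_) Qt≡0) (ℚ.*-zeroʳ (eval₁ P t))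
    ... | no  Qt≢0 = trans (cong (_*ℚ eval₁ Q t) Pt≡0) (ℚ.*-zeroˡ (eval₁ Q t))
      where
      Pt≡0 : eval₁ P t ≡ 0ℚ
      Pt≡0 = trans (eval₁-restrict ρ₀ ρ₁ p t)
                   (p≡0 (segment ρ₀ ρ₁ t) λ qt≡0 → Qt≢0 (trans (eval₁-restrict ρ₀ ρ₁ q t) qt≡0))

⊗-≉0 : ∀ p q → ¬ (p ≈ₚ con 0ℚ) → ¬ (q ≈ₚ con 0ℚ) → ¬ (p ⊗ q ≈ₚ con 0ℚ)
⊗-≉0 p q p≉0 q≉0 pq≈0 = p≉0 (vanishes-off-zeros p q q≉0 λ ρ qρ≢0 → x*y≡0⇒x≡0 qρ≢0 (pq≈0 ρ))

agree-off-zeros : ∀ D → ¬ (D ≈ₚ con 0ℚ) → ∀ p q →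
                  (∀ ρ → eval ρ D ≢ 0ℚ → eval ρ p ≡ eval ρ q) → p ≈ₚ q
agree-off-zeros D D≉0 p q p≡q ρ = x-y≡0⇒x≡y (vanishes-off-zeros (p ⊕ ⊝ q) D D≉0 difference≡0 ρ)
  where
  difference≡0 : ∀ ρ → eval ρ D ≢ 0ℚ → eval ρ p -ℚ eval ρ q ≡ 0ℚ
  difference≡0 ρ Dρ≢0 = trans (cong (_-ℚ eval ρ q) (p≡q ρ Dρ≢0)) (ℚ.+-inverseʳ (eval ρ q))

∏ : ∀ {m} → (Fin m → Poly) → Poly
∏ {zero}  f = con 1ℚ
∏ {suc m} f = f Fin.zero ⊗ ∏ (λ i → f (Fin.suc i))

∏-≉0 : ∀ {m} (f : Fin m → Poly) → (∀ i → ¬ (f i ≈ₚ con 0ℚ)) → ¬ (∏ f ≈ₚ con 0ℚ)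
∏-≉0 {zero}  f _    1≈0 = ℚ.1≢0 (1≈0 (λ _ → 0ℚ))
∏-≉0 {suc m} f f≉0 = ⊗-≉0 (f Fin.zero) (∏ (λ i → f (Fin.suc i)))
                          (f≉0 Fin.zero) (∏-≉0 (λ i → f (Fin.suc i)) (λ i → f≉0 (Fin.suc i)))

eval-∏-≢0 : ∀ {m} (f : Fin m → Poly) ρ → eval ρ (∏ f) ≢ 0ℚ → ∀ i → eval ρ (f i) ≢ 0ℚ
eval-∏-≢0 {suc m} f ρ ∏≢0 Fin.zero    = x*y≢0⇒x≢0 ∏≢0
eval-∏-≢0 {suc m} f ρ ∏≢0 (Fin.suc i) =
  eval-∏-≢0 (λ i → f (Fin.suc i)) ρ (x*y≢0⇒y≢0 {eval ρ (f Fin.zero)} ∏≢0) i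

denominators : ∀ {m} → Mat m → Poly
denominators N = ∏ (λ i → ∏ (λ j → den (N i j)))

denominators-≉0 : ∀ {m} (N : Mat m) → (∀ i j → Proper (N i j)) → ¬ (denominators N ≈ₚ con 0ℚ)
denominators-≉0 N proper = ∏-≉0 _ (λ i → ∏-≉0 _ (proper i))

eval-denominators-≢0 : ∀ {m} (N : Mat m) ρ → eval ρ (denominators N) ≢ 0ℚ →
                       ∀ i j → eval ρ (den (N i j)) ≢ 0ℚ
eval-denominators-≢0 N ρ D≢0 i = eval-∏-≢0 _ ρ (eval-∏-≢0 _ ρ D≢0 i)

record ValueAt (ρ : ℕ → ℚ) (f : Frac) (v : ℚ) : Set where
  constructor value
  field
    den≢0 : eval ρ (den f) ≢ 0ℚ
    num≡  : eval ρ (num f) ≡ v *ℚ eval ρ (den f)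

module _ {ρ : ℕ → ℚ} where

  value-↑ : ∀ p → ValueAt ρ (↑ p) (eval ρ p)
  value-↑ p = value ℚ.1≢0 (sym (ℚ.*-identityʳ (eval ρ p)))

  value-+ : ∀ {a b v v′} → ValueAt ρ a v → ValueAt ρ b v′ → ValueAt ρ (a + b) (v +ℚ v′)
  value-+ {a} {b} {v} {v′} (value α≢0 a≡) (value β≢0 b≡) =
    value (x#0y#0→xy#0 α≢0 β≢0)
          (trans (cong₂ (λ x y → x *ℚ β +ℚ y *ℚ α) a≡ b≡) (regroup v v′ α β))
    where
    α : ℚ
    α = eval ρ (den a)
    β : ℚ
    β = eval ρ (den b)
    regroup : ∀ v v′ α β → v *ℚ α *ℚ β +ℚ v′ *ℚ β *ℚ α ≡ (v +ℚ v′) *ℚ (α *ℚ β)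
    regroup = solve-∀ ℚ-ring

  value-* : ∀ {a b v v′} → ValueAt ρ a v → ValueAt ρ b v′ → ValueAt ρ (a * b) (v *ℚ v′)
  value-* {a} {b} {v} {v′} (value α≢0 a≡) (value β≢0 b≡) =
    value (x#0y#0→xy#0 α≢0 β≢0) (trans (cong₂ _*ℚ_ a≡ b≡) (regroup v v′ α β))
    where
    α : ℚ
    α = eval ρ (den a)
    β : ℚ
    β = eval ρ (den b)
    regroup : ∀ v v′ α β → v *ℚ α *ℚ (v′ *ℚ β) ≡ v *ℚ v′ *ℚ (α *ℚ β)
    regroup = solve-∀ ℚ-ring

  value-neg : ∀ {a v} → ValueAt ρ a v → ValueAt ρ (- a) (-ℚ v)
  value-neg {a} {v} (value α≢0 a≡) =
    value α≢0 (trans (cong -ℚ_ a≡) (ℚ.neg-distribˡ-* v (eval ρ (den a))))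

  value-- : ∀ {a b v v′} → ValueAt ρ a v → ValueAt ρ b v′ → ValueAt ρ (a - b) (v -ℚ v′)
  value-- a↦v b↦v′ = value-+ a↦v (value-neg b↦v′)

  value-exists : ∀ f → eval ρ (den f) ≢ 0ℚ → ∃ (ValueAt ρ f)
  value-exists f β≢0 = n *ℚ β⁻¹ , value β≢0 (begin
    n                   ≡⟨ ℚ.*-identityʳ n ⟨
    n *ℚ 1ℚ             ≡⟨ cong (n *ℚ_) (ℚ.*-inverseˡ β) ⟨
    n *ℚ (β⁻¹ *ℚ β)     ≡⟨ ℚ.*-assoc n β⁻¹ β ⟨
    n *ℚ β⁻¹ *ℚ β       ∎)
    where
    open ≡-Reasoning
    n : ℚ
    n = eval ρ (num f)
    β : ℚ
    β = eval ρ (den f)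
    instance
      β-nonZero : ℚ.NonZero β
      β-nonZero = ℚ.≢-nonZero β≢0
    β⁻¹ : ℚ
    β⁻¹ = ℚ.1/ β

  value-unique : ∀ {a b v v′} → a ≃ b → ValueAt ρ a v → ValueAt ρ b v′ → v ≡ v′
  value-unique {a} {b} {v} {v′} a≃b (value α≢0 a≡) (value β≢0 b≡) =
    x-y≡0⇒x≡y (x*y≡0⇒x≡0 (x#0y#0→xy#0 α≢0 β≢0) (begin
      (v -ℚ v′) *ℚ (α *ℚ β)                        ≡⟨ expand v v′ α β ⟩
      v *ℚ α *ℚ β -ℚ v′ *ℚ β *ℚ α                  ≡⟨ cong₂ (λ x y → x *ℚ β -ℚ y *ℚ α) a≡ b≡ ⟨
      eval ρ (num a) *ℚ β -ℚ eval ρ (num b) *ℚ α   ≡⟨ cong (_-ℚ eval ρ (num b) *ℚ α) (a≃b ρ) ⟩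
      eval ρ (num b) *ℚ α -ℚ eval ρ (num b) *ℚ α   ≡⟨ ℚ.+-inverseʳ (eval ρ (num b) *ℚ α) ⟩
      0ℚ                                           ∎))
    where
    open ≡-Reasoning
    α : ℚ
    α = eval ρ (den a)
    β : ℚ
    β = eval ρ (den b)
    expand : ∀ v v′ α β → (v -ℚ v′) *ℚ (α *ℚ β) ≡ v *ℚ α *ℚ β -ℚ v′ *ℚ β *ℚ α
    expand = solve-∀ ℚ-ring

  same-value⇒cross-eq : ∀ {a b v} → ValueAt ρ a v → ValueAt ρ b v →
                        eval ρ (num a ⊗ den b) ≡ eval ρ (num b ⊗ den a)
  same-value⇒cross-eq {a} {b} {v} (value _ a≡) (value _ b≡) = begin
    eval ρ (num a) *ℚ β     ≡⟨ cong (_*ℚ β) a≡ ⟩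
    v *ℚ α *ℚ β             ≡⟨ swap v α β ⟩
    v *ℚ β *ℚ α             ≡⟨ cong (_*ℚ α) b≡ ⟨
    eval ρ (num b) *ℚ α     ∎
    where
    open ≡-Reasoning
    α : ℚ
    α = eval ρ (den a)
    β : ℚ
    β = eval ρ (den b)
    swap : ∀ v α β → v *ℚ α *ℚ β ≡ v *ℚ β *ℚ α
    swap = solve-∀ ℚ-ring

≃-by-values : ∀ D → ¬ (D ≈ₚ con 0ℚ) → ∀ {a b} →
              (∀ ρ → eval ρ D ≢ 0ℚ → ∃ λ v → ValueAt ρ a v × ValueAt ρ b v) → a ≃ b
≃-by-values D D≉0 {a} {b} same-value =
  agree-off-zeros D D≉0 (num a ⊗ den b) (num b ⊗ den a) λ ρ Dρ≢0 →
    let (_ , a↦v , b↦v) = same-value ρ Dρ≢0 in same-value⇒cross-eq a↦v b↦v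

Matℚ : ℕ → Set
Matℚ m = Fin m → Fin m → ℚ

infixl 7 _⊙_
infixr 6 _▷_

_⊙_ : ∀ {m} → Matℚ m → Matℚ m → Matℚ m
(A ⊙ B) i j = sum (λ l → A i l *ℚ B l j)

_▷_ : ∀ {m} → Matℚ m → (Fin m → ℚ) → Fin m → ℚ
(A ▷ v) i = sum (λ j → A i j *ℚ v j)

δ : ∀ {m} → Matℚ m
δ i j = if ⌊ i Fin.≟ j ⌋ then 1ℚ else 0ℚ

δ-suc : ∀ {m} (i j : Fin m) → δ (Fin.suc i) (Fin.suc j) ≡ δ i j
δ-suc i j with i Fin.≟ j
... | yes _ = refl
... | no  _ = refl

sum-δ : ∀ {m} (i : Fin m) (v : Fin m → ℚ) → sum (λ j → δ i j *ℚ v j) ≡ v i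
sum-δ {suc m} Fin.zero v = begin
  1ℚ *ℚ v Fin.zero +ℚ sum (λ j → 0ℚ *ℚ v (Fin.suc j))
    ≡⟨ cong₂ _+ℚ_ (ℚ.*-identityˡ (v Fin.zero))
                  (trans (sum-cong-≗ (λ j → ℚ.*-zeroˡ (v (Fin.suc j)))) (sum-replicate-zero m)) ⟩
  v Fin.zero +ℚ 0ℚ
    ≡⟨ ℚ.+-identityʳ (v Fin.zero) ⟩
  v Fin.zero ∎
  where open ≡-Reasoning
sum-δ {suc m} (Fin.suc i) v = begin
  0ℚ *ℚ v Fin.zero +ℚ sum (λ j → δ (Fin.suc i) (Fin.suc j) *ℚ v (Fin.suc j))
    ≡⟨ cong₂ _+ℚ_ (ℚ.*-zeroˡ (v Fin.zero))
                  (trans (sum-cong-≗ (λ j → cong (_*ℚ v (Fin.suc j)) (δ-suc i j)))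
                         (sum-δ i (λ j → v (Fin.suc j)))) ⟩
  0ℚ +ℚ v (Fin.suc i)
    ≡⟨ ℚ.+-identityˡ (v (Fin.suc i)) ⟩
  v (Fin.suc i) ∎
  where open ≡-Reasoning

⊙≡δ⇒▷-cancel : ∀ {m} (P Q : Matℚ m) → (∀ i j → (P ⊙ Q) i j ≡ δ i j) →
               ∀ v i → (P ▷ Q ▷ v) i ≡ v i
⊙≡δ⇒▷-cancel P Q P⊙Q≡δ v i = begin
  sum (λ l → P i l *ℚ sum (λ j → Q l j *ℚ v j))
    ≡⟨ sum-cong-≗ (λ l → *-distribˡ-sum (P i l) (λ j → Q l j *ℚ v j)) ⟩
  sum (λ l → sum (λ j → P i l *ℚ (Q l j *ℚ v j)))
    ≡⟨ ∑-comm (λ l j → P i l *ℚ (Q l j *ℚ v j)) ⟩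
  sum (λ j → sum (λ l → P i l *ℚ (Q l j *ℚ v j)))
    ≡⟨ sum-cong-≗ (λ j → trans (sum-cong-≗ (λ l → sym (ℚ.*-assoc (P i l) (Q l j) (v j))))
                               (sym (*-distribʳ-sum (v j) (λ l → P i l *ℚ Q l j)))) ⟩
  sum (λ j → (P ⊙ Q) i j *ℚ v j)
    ≡⟨ sum-cong-≗ (λ j → cong (_*ℚ v j) (P⊙Q≡δ i j)) ⟩
  sum (λ j → δ i j *ℚ v j)
    ≡⟨ sum-δ i v ⟩
  v i ∎
  where open ≡-Reasoning

sum-affine : ∀ {m} (a b : Fin m → ℚ) X → sum (λ i → a i +ℚ X *ℚ b i) ≡ sum a +ℚ X *ℚ sum b
sum-affine a b X = trans (∑-distrib-+ a (λ i → X *ℚ b i)) (cong (sum a +ℚ_) (sym (*-distribˡ-sum X b)))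

sum-▷-affine : ∀ {m} (N : Matℚ m) (y z : Fin m → ℚ) X →
               sum (N ▷ (λ j → y j +ℚ z j *ℚ X)) ≡ sum (N ▷ y) +ℚ X *ℚ sum (N ▷ z)
sum-▷-affine N y z X = begin
  sum (λ i → sum (λ j → N i j *ℚ (y j +ℚ z j *ℚ X)))
    ≡⟨ sum-cong-≗ (λ i → trans (sum-cong-≗ (λ j → distribute (N i j) (y j) (z j) X))
                               (sum-affine (λ j → N i j *ℚ y j) (λ j → N i j *ℚ z j) X)) ⟩
  sum (λ i → (N ▷ y) i +ℚ X *ℚ (N ▷ z) i)
    ≡⟨ sum-affine (N ▷ y) (N ▷ z) X ⟩
  sum (N ▷ y) +ℚ X *ℚ sum (N ▷ z) ∎
  where
  open ≡-Reasoning
  distribute : ∀ n y z X → n *ℚ (y +ℚ z *ℚ X) ≡ n *ℚ y +ℚ X *ℚ (n *ℚ z)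
  distribute = solve-∀ ℚ-ring

record Bordered {m} (B : Matℚ (suc m)) (A : Matℚ m) (z : Fin m → ℚ) (γ : ℚ) : Set where
  field
    top-left     : ∀ i j → B (inject₁ i) (inject₁ j) ≡ A i j
    top-right    : ∀ i → B (inject₁ i) (fromℕ m) ≡ -ℚ z i
    bottom-left  : ∀ j → B (fromℕ m) (inject₁ j) ≡ -ℚ γ
    bottom-right : B (fromℕ m) (fromℕ m) ≡ 1ℚ

-- Write x = N′ v and X for its last entry. Since B x = v, the first m equations say
-- A (init x) = y + X z, so init x = N (y + X z); the last one then gives
-- X (1 - γ e N z) = last v + γ e N y, a Schur complement.
sum-▷-bordered : ∀ {m} (A N : Matℚ m) (B N′ : Matℚ (suc m)) z γ u → Bordered B A z γ →
                 (∀ i j → (N ⊙ A) i j ≡ δ i j) → (∀ i j → (B ⊙ N′) i j ≡ δ i j) →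
                 (1ℚ -ℚ γ *ℚ sum (N ▷ z)) *ℚ u ≡ 1ℚ →
                 ∀ v y → (∀ j → v (inject₁ j) ≡ y j) →
                 sum (N′ ▷ v) ≡ sum (N ▷ y)
                                +ℚ (last v +ℚ γ *ℚ sum (N ▷ y)) *ℚ u *ℚ (1ℚ +ℚ sum (N ▷ z))
sum-▷-bordered {m} A N B N′ z γ u bordered N⊙A≡δ B⊙N′≡δ u-inverse v y init-v≡y = begin
  sum x                        ≡⟨ sum-init-last x ⟩
  sum (init x) +ℚ X            ≡⟨ cong (_+ℚ X) sum-init-x ⟩
  G +ℚ X *ℚ H +ℚ X             ≡⟨ factor G X H ⟩
  G +ℚ X *ℚ (1ℚ +ℚ H)          ≡⟨ cong (λ X → G +ℚ X *ℚ (1ℚ +ℚ H)) X≡ ⟩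
  G +ℚ (last v +ℚ γ *ℚ G) *ℚ u *ℚ (1ℚ +ℚ H) ∎
  where
  open ≡-Reasoning
  open Bordered bordered
  x : Fin (suc m) → ℚ
  x = N′ ▷ v
  X : ℚ
  X = last x
  G : ℚ
  G = sum (N ▷ y)
  H : ℚ
  H = sum (N ▷ z)

  row : ∀ i → v i ≡ sum (λ j → B i (inject₁ j) *ℚ init x j) +ℚ B i (fromℕ m) *ℚ X
  row i = trans (sym (⊙≡δ⇒▷-cancel B N′ B⊙N′≡δ v i)) (sum-init-last (λ j → B i j *ℚ x j))

  top : ∀ i → (A ▷ init x) i ≡ y i +ℚ z i *ℚ X
  top i = begin
    S                               ≡⟨ shift S (z i) X ⟩
    S +ℚ (-ℚ z i) *ℚ X +ℚ z i *ℚ X  ≡⟨ cong (_+ℚ z i *ℚ X) top-row ⟩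
    y i +ℚ z i *ℚ X                 ∎
    where
    S : ℚ
    S = (A ▷ init x) i
    shift : ∀ s z X → s ≡ s +ℚ (-ℚ z) *ℚ X +ℚ z *ℚ X
    shift = solve-∀ ℚ-ring
    top-row : S +ℚ (-ℚ z i) *ℚ X ≡ y i
    top-row = begin
      S +ℚ (-ℚ z i) *ℚ X
        ≡⟨ cong₂ _+ℚ_ (sum-cong-≗ (λ j → cong (_*ℚ init x j) (top-left i j)))
                      (cong (_*ℚ X) (top-right i)) ⟨
      sum (λ j → B (inject₁ i) (inject₁ j) *ℚ init x j) +ℚ B (inject₁ i) (fromℕ m) *ℚ X
        ≡⟨ row (inject₁ i) ⟨
      v (inject₁ i)
        ≡⟨ init-v≡y i ⟩
      y i ∎

  bottom : (-ℚ γ) *ℚ sum (init x) +ℚ X ≡ last v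
  bottom = begin
    (-ℚ γ) *ℚ sum (init x) +ℚ X
      ≡⟨ cong₂ _+ℚ_ (*-distribˡ-sum (-ℚ γ) (init x)) (sym (ℚ.*-identityˡ X)) ⟩
    sum (λ j → (-ℚ γ) *ℚ init x j) +ℚ 1ℚ *ℚ X
      ≡⟨ cong₂ _+ℚ_ (sum-cong-≗ (λ j → cong (_*ℚ init x j) (bottom-left j)))
                    (cong (_*ℚ X) bottom-right) ⟨
    sum (λ j → B (fromℕ m) (inject₁ j) *ℚ init x j) +ℚ B (fromℕ m) (fromℕ m) *ℚ X
      ≡⟨ row (fromℕ m) ⟨
    last v ∎

  sum-init-x : sum (init x) ≡ G +ℚ X *ℚ H
  sum-init-x = begin
    sum (init x)                          ≡⟨ sum-cong-≗ (⊙≡δ⇒▷-cancel N A N⊙A≡δ (init x)) ⟨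
    sum (N ▷ A ▷ init x)                  ≡⟨ sum-cong-≗ (λ i → sum-cong-≗ (λ j → cong (N i j *ℚ_) (top j))) ⟩
    sum (N ▷ (λ j → y j +ℚ z j *ℚ X))     ≡⟨ sum-▷-affine N y z X ⟩
    G +ℚ X *ℚ H                           ∎

  X≡ : X ≡ (last v +ℚ γ *ℚ G) *ℚ u
  X≡ = begin
    X                                               ≡⟨ ℚ.*-identityʳ X ⟨
    X *ℚ 1ℚ                                         ≡⟨ cong (X *ℚ_) u-inverse ⟨
    X *ℚ ((1ℚ -ℚ γ *ℚ H) *ℚ u)                      ≡⟨ expand X γ G H u ⟩
    ((-ℚ γ) *ℚ (G +ℚ X *ℚ H) +ℚ X +ℚ γ *ℚ G) *ℚ u
      ≡⟨ cong (λ s → ((-ℚ γ) *ℚ s +ℚ X +ℚ γ *ℚ G) *ℚ u) sum-init-x ⟨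
    ((-ℚ γ) *ℚ sum (init x) +ℚ X +ℚ γ *ℚ G) *ℚ u    ≡⟨ cong (λ s → (s +ℚ γ *ℚ G) *ℚ u) bottom ⟩
    (last v +ℚ γ *ℚ G) *ℚ u                         ∎
    where
    expand : ∀ X γ G H u → X *ℚ ((1ℚ -ℚ γ *ℚ H) *ℚ u) ≡ ((-ℚ γ) *ℚ (G +ℚ X *ℚ H) +ℚ X +ℚ γ *ℚ G) *ℚ u
    expand = solve-∀ ℚ-ring

  factor : ∀ G X H → G +ℚ X *ℚ H +ℚ X ≡ G +ℚ X *ℚ (1ℚ +ℚ H)
  factor = solve-∀ ℚ-ring

⌊⌋-true : ∀ {A : Set} (a? : Dec A) → A → ⌊ a? ⌋ ≡ true
⌊⌋-true a? a = trans (isYes≗does a?) (dec-true a? a)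

⌊⌋-false : ∀ {A : Set} (a? : Dec A) → ¬ A → ⌊ a? ⌋ ≡ false
⌊⌋-false a? ¬a = trans (isYes≗does a?) (dec-false a? ¬a)

⌊inject₁≟inject₁⌋ : ∀ {m} (i j : Fin m) → ⌊ inject₁ i Fin.≟ inject₁ j ⌋ ≡ ⌊ i Fin.≟ j ⌋
⌊inject₁≟inject₁⌋ i j with i Fin.≟ j
... | yes refl = ⌊⌋-true (inject₁ i Fin.≟ inject₁ i) refl
... | no  i≢j  = ⌊⌋-false (inject₁ i Fin.≟ inject₁ j) (i≢j ∘ inject₁-injective)

M-entry : (ℕ → ℚ) → Bool → ℕ → ℕ → ℚ
M-entry ρ diagonal a c =
  if diagonal then 1ℚ
  else (if ⌊ c ℕ.≟ suc a ⌋ then -ℚ (ρ (suc a) *ℚ ρ 0) else -ℚ ρ (suc a))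

Mℚ : (ℕ → ℚ) → (m : ℕ) → Matℚ m
Mℚ ρ m i j = M-entry ρ ⌊ i Fin.≟ j ⌋ (toℕ i) (toℕ j)

yℚ : (ℕ → ℚ) → (m : ℕ) → Fin m → ℚ
yℚ ρ m j = ρ (suc (toℕ j))

zℚ : (ℕ → ℚ) → (m : ℕ) → Fin m → ℚ
zℚ ρ m j = if ⌊ suc (toℕ j) ℕ.≟ m ⌋ then ρ 0 *ℚ ρ m else ρ (suc (toℕ j))

M-entry-last-column : ∀ ρ a m → M-entry ρ false a m ≡ -ℚ (if ⌊ suc a ℕ.≟ m ⌋ then ρ 0 *ℚ ρ m else ρ (suc a))
M-entry-last-column ρ a m with suc a ℕ.≟ m
... | yes a+1≡m rewrite ⌊⌋-true (m ℕ.≟ suc a) (sym a+1≡m) =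
  trans (cong -ℚ_ (ℚ.*-comm (ρ (suc a)) (ρ 0))) (cong (λ k → -ℚ (ρ 0 *ℚ ρ k)) a+1≡m)
... | no  a+1≢m rewrite ⌊⌋-false (m ℕ.≟ suc a) (a+1≢m ∘ sym) = refl

M-bordered : ∀ ρ m → Bordered (Mℚ ρ (suc m)) (Mℚ ρ m) (zℚ ρ m) (ρ (suc m))
M-bordered ρ m = record
  { top-left     = top-left
  ; top-right    = top-right
  ; bottom-left  = bottom-left
  ; bottom-right = cong (λ b → M-entry ρ b (toℕ (fromℕ m)) (toℕ (fromℕ m)))
                        (⌊⌋-true (fromℕ m Fin.≟ fromℕ m) refl)
  }
  where
  top-left : ∀ i j → Mℚ ρ (suc m) (inject₁ i) (inject₁ j) ≡ Mℚ ρ m i j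
  top-left i j rewrite ⌊inject₁≟inject₁⌋ i j | toℕ-inject₁ i | toℕ-inject₁ j = refl

  top-right : ∀ i → Mℚ ρ (suc m) (inject₁ i) (fromℕ m) ≡ -ℚ zℚ ρ m i
  top-right i
    rewrite ⌊⌋-false (inject₁ i Fin.≟ fromℕ m) (fromℕ≢inject₁ ∘ sym) | toℕ-inject₁ i | toℕ-fromℕ m
    = M-entry-last-column ρ (toℕ i) m

  bottom-left : ∀ j → Mℚ ρ (suc m) (fromℕ m) (inject₁ j) ≡ -ℚ ρ (suc m)
  bottom-left j
    rewrite ⌊⌋-false (fromℕ m Fin.≟ inject₁ j) fromℕ≢inject₁ | toℕ-inject₁ j | toℕ-fromℕ m
          | ⌊⌋-false (toℕ j ℕ.≟ suc m) (λ j≡1+m → ℕ.<⇒≢ (ℕ.m<n⇒m<1+n (toℕ<n j)) j≡1+m)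
    = refl

zℚ-inject₁ : ∀ ρ m (j : Fin m) → zℚ ρ (suc m) (inject₁ j) ≡ yℚ ρ m j
zℚ-inject₁ ρ m j
  rewrite toℕ-inject₁ j | ⌊⌋-false (suc (toℕ j) ℕ.≟ suc m) (ℕ.<⇒≢ (ℕ.s<s (toℕ<n j))) = refl

yℚ-inject₁ : ∀ ρ m (j : Fin m) → yℚ ρ (suc m) (inject₁ j) ≡ yℚ ρ m j
yℚ-inject₁ ρ m j = cong (ρ ∘ suc) (toℕ-inject₁ j)

zℚ-last : ∀ ρ m → zℚ ρ (suc m) (fromℕ m) ≡ ρ 0 *ℚ ρ (suc m)
zℚ-last ρ m rewrite toℕ-fromℕ m | ⌊⌋-true (suc m ℕ.≟ suc m) refl = refl

yℚ-last : ∀ ρ m → yℚ ρ (suc m) (fromℕ m) ≡ ρ (suc m)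
yℚ-last ρ m = cong (ρ ∘ suc) (toℕ-fromℕ m)

recurrence-at : ∀ ρ m (n : Matℚ m) (n′ : Matℚ (suc m)) u →
                (∀ i j → (n ⊙ Mℚ ρ m) i j ≡ δ i j) → (∀ i j → (Mℚ ρ (suc m) ⊙ n′) i j ≡ δ i j) →
                (1ℚ -ℚ ρ (suc m) *ℚ sum (n ▷ zℚ ρ m)) *ℚ u ≡ 1ℚ →
                (sum (n′ ▷ yℚ ρ (suc m))
                   ≡ sum (n ▷ yℚ ρ m) +ℚ ρ (suc m) *ℚ (1ℚ +ℚ sum (n ▷ yℚ ρ m))
                                        *ℚ (1ℚ +ℚ sum (n ▷ zℚ ρ m)) *ℚ u)
              × (sum (n′ ▷ zℚ ρ (suc m))
                   ≡ sum (n ▷ yℚ ρ m) +ℚ ρ (suc m) *ℚ (ρ 0 +ℚ sum (n ▷ yℚ ρ m))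
                                        *ℚ (1ℚ +ℚ sum (n ▷ zℚ ρ m)) *ℚ u)
recurrence-at ρ m n n′ u n⊙M≡δ M⊙n′≡δ u-inverse =
  trans (schur (yℚ ρ (suc m)) (yℚ-inject₁ ρ m) (yℚ-last ρ m)) (rearrange-𝒢 G H γ u) ,
  trans (schur (zℚ ρ (suc m)) (zℚ-inject₁ ρ m) (zℚ-last ρ m)) (rearrange-ℋ G H γ u (ρ 0))
  where
  γ : ℚ
  γ = ρ (suc m)
  G : ℚ
  G = sum (n ▷ yℚ ρ m)
  H : ℚ
  H = sum (n ▷ zℚ ρ m)

  schur : ∀ v → (∀ j → v (inject₁ j) ≡ yℚ ρ m j) → ∀ {c} → last v ≡ c →
          sum (n′ ▷ v) ≡ G +ℚ (c +ℚ γ *ℚ G) *ℚ u *ℚ (1ℚ +ℚ H)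
  schur v init-v≡y last-v≡c =
    trans (sum-▷-bordered (Mℚ ρ m) n (Mℚ ρ (suc m)) n′ (zℚ ρ m) γ u (M-bordered ρ m)
                          n⊙M≡δ M⊙n′≡δ u-inverse v (yℚ ρ m) init-v≡y)
          (cong (λ c → G +ℚ (c +ℚ γ *ℚ G) *ℚ u *ℚ (1ℚ +ℚ H)) last-v≡c)

  rearrange-𝒢 : ∀ G H γ u → G +ℚ (γ +ℚ γ *ℚ G) *ℚ u *ℚ (1ℚ +ℚ H) ≡ G +ℚ γ *ℚ (1ℚ +ℚ G) *ℚ (1ℚ +ℚ H) *ℚ u
  rearrange-𝒢 = solve-∀ ℚ-ring

  rearrange-ℋ : ∀ G H γ u w → G +ℚ (w *ℚ γ +ℚ γ *ℚ G) *ℚ u *ℚ (1ℚ +ℚ H) ≡ G +ℚ γ *ℚ (w +ℚ G) *ℚ (1ℚ +ℚ H) *ℚ u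
  rearrange-ℋ = solve-∀ ℚ-ring

module _ {ρ : ℕ → ℚ} where

  value-if : ∀ b {x y u v} → ValueAt ρ x u → ValueAt ρ y v →
             ValueAt ρ (if b then x else y) (if b then u else v)
  value-if true  x↦u _   = x↦u
  value-if false _   y↦v = y↦v

  value-Σ : ∀ {m} {f : Fin m → Frac} {v : Fin m → ℚ} →
            (∀ i → ValueAt ρ (f i) (v i)) → ValueAt ρ (Σ f) (sum v)
  value-Σ {zero}  _   = value-↑ (con 0ℚ)
  value-Σ {suc m} f↦v = value-+ (f↦v Fin.zero) (value-Σ (λ i → f↦v (Fin.suc i)))

  value-· : ∀ {m} {A B : Mat m} {a b : Matℚ m} →
            (∀ i j → ValueAt ρ (A i j) (a i j)) → (∀ i j → ValueAt ρ (B i j) (b i j)) →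
            ∀ i j → ValueAt ρ ((A · B) i j) ((a ⊙ b) i j)
  value-· A↦a B↦b i j = value-Σ (λ l → value-* (A↦a i l) (B↦b l j))

  value-eNv : ∀ {m} {N : Mat m} {n : Matℚ m} {v : Fin m → Frac} {vq : Fin m → ℚ} →
              (∀ i j → ValueAt ρ (N i j) (n i j)) → (∀ j → ValueAt ρ (v j) (vq j)) →
              ValueAt ρ (eNv N v) (sum (n ▷ vq))
  value-eNv N↦n v↦vq = value-Σ (λ i → value-Σ (λ j → value-* (N↦n i j) (v↦vq j)))

  value-I : ∀ {m} (i j : Fin m) → ValueAt ρ (I i j) (δ i j)
  value-I i j = value-if ⌊ i Fin.≟ j ⌋ (value-↑ (con 1ℚ)) (value-↑ (con 0ℚ))

  value-M : ∀ m i j → ValueAt ρ (M m i j) (Mℚ ρ m i j)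
  value-M m i j =
    value-if ⌊ i Fin.≟ j ⌋ (value-↑ (con 1ℚ))
      (value-if ⌊ toℕ j ℕ.≟ suc (toℕ i) ⌋
        (value-neg (value-* (value-↑ (var (suc (toℕ i)))) (value-↑ (var 0))))
        (value-neg (value-↑ (var (suc (toℕ i))))))

  value-y : ∀ m j → ValueAt ρ (y m j) (yℚ ρ m j)
  value-y m j = value-↑ (var (suc (toℕ j)))

  value-z : ∀ m j → ValueAt ρ (z m j) (zℚ ρ m j)
  value-z m j = value-if ⌊ suc (toℕ j) ℕ.≟ m ⌋
                  (value-* (value-↑ (var 0)) (value-↑ (var m))) (value-↑ (var (suc (toℕ j))))

record InverseOfMAt (ρ : ℕ → ℚ) (m : ℕ) (N : Mat m) : Set where
  field
    entries       : Matℚ m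
    left-inverse  : ∀ i j → (entries ⊙ Mℚ ρ m) i j ≡ δ i j
    right-inverse : ∀ i j → (Mℚ ρ m ⊙ entries) i j ≡ δ i j
    𝒢-value       : ValueAt ρ (𝒢 m N) (sum (entries ▷ yℚ ρ m))
    ℋ-value       : ValueAt ρ (ℋ m N) (sum (entries ▷ zℚ ρ m))

inverse-at : ∀ ρ m (N : Mat m) → IsInverse (M m) N → eval ρ (denominators N) ≢ 0ℚ →
             InverseOfMAt ρ m N
inverse-at ρ m N (_ , M·N≃I , N·M≃I) D≢0 = record
  { entries       = n
  ; left-inverse  = λ i j → value-unique (N·M≃I i j) (value-· N↦n (value-M m) i j) (value-I i j)
  ; right-inverse = λ i j → value-unique (M·N≃I i j) (value-· (value-M m) N↦n i j) (value-I i j)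
  ; 𝒢-value       = value-eNv N↦n (value-y m)
  ; ℋ-value       = value-eNv N↦n (value-z m)
  }
  where
  entry-value : ∀ i j → ∃ (ValueAt ρ (N i j))
  entry-value i j = value-exists (N i j) (eval-denominators-≢0 N ρ D≢0 i j)
  n : Matℚ m
  n i j = proj₁ (entry-value i j)
  N↦n : ∀ i j → ValueAt ρ (N i j) (n i j)
  N↦n i j = proj₂ (entry-value i j)

-- The recurrence from m = 0, where 𝒢₀ and ℋ₀ are empty sums.
initial-values-at : ∀ ρ (n : Matℚ 1) → (∀ i j → (Mℚ ρ 1 ⊙ n) i j ≡ δ i j) →
                    (sum (n ▷ yℚ ρ 1) ≡ ρ 1) × (sum (n ▷ zℚ ρ 1) ≡ ρ 0 *ℚ ρ 1)
initial-values-at ρ n M⊙n≡δ =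
  trans (proj₁ from-0) (simplify-𝒢 (ρ 1)) , trans (proj₂ from-0) (simplify-ℋ (ρ 0) (ρ 1))
  where
  u-inverse : ∀ γ → (1ℚ -ℚ γ *ℚ 0ℚ) *ℚ 1ℚ ≡ 1ℚ
  u-inverse = solve-∀ ℚ-ring
  simplify-𝒢 : ∀ γ → 0ℚ +ℚ γ *ℚ (1ℚ +ℚ 0ℚ) *ℚ (1ℚ +ℚ 0ℚ) *ℚ 1ℚ ≡ γ
  simplify-𝒢 = solve-∀ ℚ-ring
  simplify-ℋ : ∀ w γ → 0ℚ +ℚ γ *ℚ (w +ℚ 0ℚ) *ℚ (1ℚ +ℚ 0ℚ) *ℚ 1ℚ ≡ w *ℚ γ
  simplify-ℋ = solve-∀ ℚ-ring
  from-0 : (sum (n ▷ yℚ ρ 1) ≡ 0ℚ +ℚ ρ 1 *ℚ (1ℚ +ℚ 0ℚ) *ℚ (1ℚ +ℚ 0ℚ) *ℚ 1ℚ)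
         × (sum (n ▷ zℚ ρ 1) ≡ 0ℚ +ℚ ρ 1 *ℚ (ρ 0 +ℚ 0ℚ) *ℚ (1ℚ +ℚ 0ℚ) *ℚ 1ℚ)
  from-0 = recurrence-at ρ 0 (λ ()) n 1ℚ (λ ()) M⊙n≡δ (u-inverse (ρ 1))

initial-values : (N₁ : Mat 1) → IsInverse (M 1) N₁ → (𝒢 1 N₁ ≃ g 1) × (ℋ 1 N₁ ≃ w * g 1)
initial-values N₁ inverse =
  ≃-by-values D D≉0 (λ ρ D≢0 →
    let open InverseOfMAt (inverse-at ρ 1 N₁ inverse D≢0) in
    _ , 𝒢-value , subst (ValueAt ρ (g 1)) (sym (proj₁ (initial-values-at ρ entries right-inverse)))
                        (value-↑ (var 1))) ,
  ≃-by-values D D≉0 (λ ρ D≢0 →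
    let open InverseOfMAt (inverse-at ρ 1 N₁ inverse D≢0) in
    _ , ℋ-value , subst (ValueAt ρ (w * g 1)) (sym (proj₂ (initial-values-at ρ entries right-inverse)))
                        (value-* (value-↑ (var 0)) (value-↑ (var 1))))
  where
  D : Poly
  D = denominators N₁
  D≉0 : ¬ (D ≈ₚ con 0ℚ)
  D≉0 = denominators-≉0 N₁ (proj₁ inverse)

recurrence : ∀ m (N : Mat m) → IsInverse (M m) N → (N′ : Mat (suc m)) → IsInverse (M (suc m)) N′ →
             (u : Frac) → Proper u → (1F - g (suc m) * ℋ m N) * u ≃ 1F →
             (𝒢 (suc m) N′ ≃ 𝒢 m N + g (suc m) * (1F + 𝒢 m N) * (1F + ℋ m N) * u)
           × (ℋ (suc m) N′ ≃ 𝒢 m N + g (suc m) * (w + 𝒢 m N) * (1F + ℋ m N) * u)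
recurrence m N inverse N′ inverse′ u u-proper u-inverse =
  ≃-by-values D D≉0 (λ ρ D≢0 → let open AtPoint ρ D≢0 in
    _ , P′.𝒢-value , subst (ValueAt ρ _) (sym (proj₁ recurrence-values))
                           (value-rhs (value-+ (value-↑ (con 1ℚ)) P.𝒢-value))) ,
  ≃-by-values D D≉0 (λ ρ D≢0 → let open AtPoint ρ D≢0 in
    _ , P′.ℋ-value , subst (ValueAt ρ _) (sym (proj₂ recurrence-values))
                           (value-rhs (value-+ (value-↑ (var 0)) P.𝒢-value)))
  where
  D : Poly
  D = denominators N ⊗ denominators N′ ⊗ den u
  D≉0 : ¬ (D ≈ₚ con 0ℚ)
  D≉0 = ⊗-≉0 (denominators N ⊗ denominators N′) (den u)
              (⊗-≉0 (denominators N) (denominators N′)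
                    (denominators-≉0 N (proj₁ inverse)) (denominators-≉0 N′ (proj₁ inverse′)))
              u-proper

  module AtPoint (ρ : ℕ → ℚ) (D≢0 : eval ρ D ≢ 0ℚ) where
    D₁D₂≢0 : eval ρ (denominators N ⊗ denominators N′) ≢ 0ℚ
    D₁D₂≢0 = x*y≢0⇒x≢0 {eval ρ (denominators N ⊗ denominators N′)} D≢0
    module P  = InverseOfMAt (inverse-at ρ m N inverse (x*y≢0⇒x≢0 {eval ρ (denominators N)} D₁D₂≢0))
    module P′ = InverseOfMAt
      (inverse-at ρ (suc m) N′ inverse′ (x*y≢0⇒y≢0 {eval ρ (denominators N)} D₁D₂≢0))
    value-u : ∃ (ValueAt ρ u)
    value-u = value-exists u (x*y≢0⇒y≢0 {eval ρ (denominators N ⊗ denominators N′)} D≢0)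
    uq : ℚ
    uq = proj₁ value-u
    u↦uq : ValueAt ρ u uq
    u↦uq = proj₂ value-u

    G H : ℚ
    G = sum (P.entries ▷ yℚ ρ m)
    H = sum (P.entries ▷ zℚ ρ m)

    value-rhs : ∀ {a α} → ValueAt ρ a α →
                ValueAt ρ (𝒢 m N + g (suc m) * a * (1F + ℋ m N) * u)
                          (G +ℚ ρ (suc m) *ℚ α *ℚ (1ℚ +ℚ H) *ℚ uq)
    value-rhs a↦α =
      value-+ P.𝒢-value
        (value-* (value-* (value-* (value-↑ (var (suc m))) a↦α)
                          (value-+ (value-↑ (con 1ℚ)) P.ℋ-value)) u↦uq)

    recurrence-values :
        (sum (P′.entries ▷ yℚ ρ (suc m)) ≡ G +ℚ ρ (suc m) *ℚ (1ℚ +ℚ G) *ℚ (1ℚ +ℚ H) *ℚ uq)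
      × (sum (P′.entries ▷ zℚ ρ (suc m)) ≡ G +ℚ ρ (suc m) *ℚ (ρ 0 +ℚ G) *ℚ (1ℚ +ℚ H) *ℚ uq)
    recurrence-values =
      recurrence-at ρ m P.entries P′.entries uq P.left-inverse P′.right-inverse
        (value-unique u-inverse
          (value-* (value-- (value-↑ (con 1ℚ)) (value-* (value-↑ (var (suc m))) P.ℋ-value)) u↦uq)
          (value-↑ (con 1ℚ)))

theorem1 : (k : ℕ) → 2 ≤ k →
    ((N₁ : Mat 1) → IsInverse (M 1) N₁ →
        (𝒢 1 N₁ ≃ g 1) × (ℋ 1 N₁ ≃ w * g 1))
    ×
    ((N : Mat (k ∸ 1)) → IsInverse (M (k ∸ 1)) N →
     (N′ : Mat k) → IsInverse (M k) N′ →
     (u : Frac) → Proper u → (1F - g k * ℋ (k ∸ 1) N) * u ≃ 1F →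
        (𝒢 k N′ ≃ 𝒢 (k ∸ 1) N
                  + g k * (1F + 𝒢 (k ∸ 1) N) * (1F + ℋ (k ∸ 1) N) * u)
      × (ℋ k N′ ≃ 𝒢 (k ∸ 1) N
                  + g k * (w + 𝒢 (k ∸ 1) N) * (1F + ℋ (k ∸ 1) N) * u))
theorem1 (suc (suc m)) (s≤s (s≤s z≤n)) = initial-values , recurrence (suc m)
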